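{- Let $G=(V,E)$ be a nonempty finite graph in which every vertex carries a loop, let $uv$ be an arbitrary edge of $G$ with $u\neq v$, and let $H$ be the graph obtained from $G$ by deleting the edge $uv$ (all loops kept). Let $f$ be an optimal opinion function of $G$. Then: (i) if $f(u)=f(v)=1$, then $-4\le \gamma(G)-\gamma(H)\le 2$; (ii) if $f(u)=f(v)=-1$, then $0\le \gamma(G)-\gamma(H)\le 2$; (iii) otherwise (i.e. $f(u)\neq f(v)$), $-2\le \gamma(G)-\gamma(H)\le 2$.
   Context: All graphs are finite with vertex set $V$, $|V|=n$, and every vertex has a loop. For $v\in V$, the neighborhood $N_v=\{w\in V:(v,w)\in E\}$ contains $v$ itself. An opinion function is a map $f:V\to\{ -1,1\}$, extended to subsets by $f(W)=\sum_{w\in W}f(w)$. A vertex $v$ votes "for" if $f(N_v)>0$ and "against" otherwise; $V^+=\{v\in V: f(N_v)>0\}$. The opinion function $f$ is strictly majoritarian on the graph if $|V^+|>|V|/2$. The strict domination number is $\gamma(G)=\min\{f(V): f \text{ strictly majoritarian on } G\}$, and an opinion function of $G$ is optimal if it is strictly majoritarian on $G$ and $f(V)=\gamma(G)$. -}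

module Defs where

open import Data.Nat as ℕ using (ℕ; zero; suc)
open import Data.Integer as ℤ using (ℤ; +_; -[1+_]; 0ℤ; 1ℤ; -1ℤ)
open import Data.Fin using (Fin; zero; suc; _≟_)
open import Data.Bool using (Bool; true; false; _∧_; _∨_; not; if_then_else_)
open import Data.Product using (Σ; _×_; _,_)
open import Relation.Nullary using (¬_; does; yes; no)
open import Data.Empty using (⊥-elim)
open import Relation.Binary.PropositionalEquality using (_≡_; refl)

record Graph (n : ℕ) : Set where
  field
    adj   : Fin n → Fin n → Bool
    sym   : ∀ v w → adj v w ≡ adj w v
    loops : ∀ v → adj v v ≡ true
open Graph public

-- Opinion function f : V → {-1,1}; true represents +1, false represents -1.
Opinion : ℕ → Set
Opinion n = Fin n → Bool

val : Bool → ℤ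
val true  = 1ℤ
val false = -1ℤ

∑ : ∀ {n} → (Fin n → ℤ) → ℤ
∑ {zero}  g = 0ℤ
∑ {suc n} g = g zero ℤ.+ ∑ (λ i → g (suc i))

count : ∀ {n} → (Fin n → Bool) → ℕ
count {zero}  p = 0
count {suc n} p = (if p zero then 1 else 0) ℕ.+ count (λ i → p (suc i))

total : ∀ {n} → Opinion n → ℤ
total f = ∑ (λ w → val (f w))

nbhdSum : ∀ {n} → Graph n → Opinion n → Fin n → ℤ
nbhdSum G f v = ∑ (λ w → if adj G v w then val (f w) else 0ℤ)

votesFor : ∀ {n} → Graph n → Opinion n → Fin n → Bool
votesFor G f v = does (0ℤ ℤ.<? nbhdSum G f v)

numFor : ∀ {n} → Graph n → Opinion n → ℕ
numFor G f = count (votesFor G f)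

-- strictly majoritarian: |V⁺| > |V|/2, i.e. 2|V⁺| > n
StrictlyMajoritarian : ∀ {n} → Graph n → Opinion n → Set
StrictlyMajoritarian {n} G f = n ℕ.< 2 ℕ.* numFor G f

IsStrictDomNumber : ∀ {n} → Graph n → ℤ → Set
IsStrictDomNumber {n} G g =
  Σ (Opinion n) (λ f → StrictlyMajoritarian G f × total f ≡ g)
  × (∀ (f : Opinion n) → StrictlyMajoritarian G f → g ℤ.≤ total f)

Optimal : ∀ {n} → Graph n → Opinion n → Set
Optimal {n} G f =
  StrictlyMajoritarian G f
  × (∀ (f' : Opinion n) → StrictlyMajoritarian G f' → total f ℤ.≤ total f')

deleteEdge : ∀ {n} (G : Graph n) (u v : Fin n) → ¬ (u ≡ v) → Graph n
deleteEdge {n} G u v u≢v = record { adj = a ; sym = s ; loops = l }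
  where
  isUV : Fin n → Fin n → Bool
  isUV x y = (does (x ≟ u) ∧ does (y ≟ v)) ∨ (does (x ≟ v) ∧ does (y ≟ u))
  a : Fin n → Fin n → Bool
  a x y = adj G x y ∧ not (isUV x y)
  s : ∀ x y → a x y ≡ a y x
  s x y rewrite sym G x y
    with does (x ≟ u) | does (y ≟ v) | does (x ≟ v) | does (y ≟ u)
  ... | p | q | r | t = lemma (adj G y x) p q r t
    where
    open import Data.Bool.Properties using (∨-comm; ∧-comm)
    lemma : ∀ b p q r t → (b ∧ not ((p ∧ q) ∨ (r ∧ t))) ≡ (b ∧ not ((t ∧ r) ∨ (q ∧ p)))
    lemma b p q r t rewrite ∧-comm t r | ∧-comm q p | ∨-comm (p ∧ q) (r ∧ t) = refl
  l : ∀ x → a x x ≡ true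
  l x with x ≟ u | x ≟ v
  ... | yes refl | yes refl = ⊥-elim (u≢v refl)
  ... | yes _ | no _ rewrite loops G x = refl
  ... | no _ | yes _ rewrite loops G x = refl
  ... | no _ | no _ rewrite loops G x = refl

{-# OPTIONS --safe #-}
-- Deleting the edge uv changes only f(N_u) and f(N_v), each by the opinion of the other
-- endpoint. So a strictly majoritarian opinion of one graph becomes one of the other after
-- promoting a few vertices from −1 to +1; a promotion never lowers any f(N_y) and costs 2
-- in f(V). From H to G it suffices to promote an endpoint of opinion −1, if there is one.
-- From G to H nothing is needed when f(u) = f(v) = −1, and promoting the endpoint of
-- opinion −1 suffices when f(u) ≠ f(v). When f(u) = f(v) = 1, an endpoint voting for in G
-- still has f(N_H) ≥ 0, and promoting one −1 vertex of its H-neighbourhood restores its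
-- vote, at a total cost of at most 4.
module Submission where

open import Defs hiding (sym)
open import Data.Nat using (ℕ; suc)
open import Data.Integer using (ℤ; _-_; _≤_; +_; -[1+_])
open import Data.Fin using (Fin)
open import Data.Bool using (Bool; true; false)
open import Data.Product using (_×_)
open import Relation.Nullary using (¬_)
open import Relation.Binary.PropositionalEquality using (_≡_)

import Data.Bool as 𝔹
import Data.Bool.Properties as 𝔹
open import Data.Bool using (if_then_else_)
open import Data.Fin using (zero; suc; _≟_)
open import Data.Fin.Properties using (suc-injective; any?)
open import Data.Integer using (_+_; _<_; -_; 0ℤ; 1ℤ; -1ℤ; _<?_; +≤+; +<+; -≤+)
import Data.Integer.Properties as ℤ
open import Data.Integer.Tactic.RingSolver using (solve-∀)
import Data.Nat as ℕ
import Data.Nat.Properties as ℕ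
open import Data.Product using (∃-syntax; _,_)
open import Data.Sum using (_⊎_; inj₁; inj₂)
open import Data.Vec.Functional using (updateAt)
open import Data.Vec.Functional.Properties using (updateAt-updates; updateAt-minimal)
open import Function using (_∘_; const)
open import Relation.Nullary using (Dec; does; yes; no; contradiction)
open import Relation.Nullary.Decidable using (_×-dec_; dec-true; dec-false)
open import Relation.Binary.PropositionalEquality
  using (_≢_; refl; sym; trans; cong; cong₂; subst; module ≡-Reasoning)

∑-cong : ∀ {n} {g h : Fin n → ℤ} → (∀ x → g x ≡ h x) → ∑ g ≡ ∑ h
∑-cong {ℕ.zero}  g≗h = refl
∑-cong {suc n} g≗h = cong₂ _+_ (g≗h zero) (∑-cong (g≗h ∘ suc))

∑-mono-≤ : ∀ {n} {g h : Fin n → ℤ} → (∀ x → g x ≤ h x) → ∑ g ≤ ∑ h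
∑-mono-≤ {ℕ.zero}  g≤h = ℤ.≤-refl
∑-mono-≤ {suc n} g≤h = ℤ.+-mono-≤ (g≤h zero) (∑-mono-≤ (g≤h ∘ suc))

∑-nonneg : ∀ {n} {g : Fin n → ℤ} → (∀ x → 0ℤ ≤ g x) → 0ℤ ≤ ∑ g
∑-nonneg {ℕ.zero}  g≥0 = ℤ.≤-refl
∑-nonneg {suc n} g≥0 = ℤ.+-mono-≤ (g≥0 zero) (∑-nonneg (g≥0 ∘ suc))

∑-pos : ∀ {n} {g : Fin n → ℤ} (x : Fin n) → (∀ y → 0ℤ ≤ g y) → 0ℤ < g x → 0ℤ < ∑ g
∑-pos zero    g≥0 gx>0 = ℤ.+-mono-<-≤ gx>0 (∑-nonneg (g≥0 ∘ suc))
∑-pos (suc x) g≥0 gx>0 = ℤ.+-mono-≤-< (g≥0 zero) (∑-pos x (g≥0 ∘ suc) gx>0)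

∑-update : ∀ {n} {g h : Fin n → ℤ} (w : Fin n) →
           (∀ x → x ≢ w → h x ≡ g x) → ∑ h ≡ ∑ g + (h w - g w)
∑-update {g = g} {h} zero h≗g = begin
  h zero + ∑ (h ∘ suc)                       ≡⟨ cong (λ s → h zero + s) (∑-cong (λ x → h≗g (suc x) λ ())) ⟩
  h zero + ∑ (g ∘ suc)                       ≡⟨ shift (h zero) (g zero) (∑ (g ∘ suc)) ⟩
  g zero + ∑ (g ∘ suc) + (h zero - g zero)   ∎
  where
  open ≡-Reasoning
  shift : ∀ a b s → a + s ≡ b + s + (a - b)
  shift = solve-∀
∑-update {g = g} {h} (suc w) h≗g = begin
  h zero + ∑ (h ∘ suc)                              ≡⟨ cong₂ _+_ (h≗g zero λ ()) (∑-update w tail-agree) ⟩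
  g zero + (∑ (g ∘ suc) + (h (suc w) - g (suc w)))  ≡⟨ ℤ.+-assoc (g zero) _ _ ⟨
  g zero + ∑ (g ∘ suc) + (h (suc w) - g (suc w))    ∎
  where
  open ≡-Reasoning
  tail-agree : ∀ x → x ≢ w → h (suc x) ≡ g (suc x)
  tail-agree x x≢w = h≗g (suc x) (x≢w ∘ suc-injective)

_⊑_ : ∀ {n} → Opinion n → Opinion n → Set
f ⊑ g = ∀ w → f w 𝔹.≤ g w

⊑-refl : ∀ {n} {f : Opinion n} → f ⊑ f
⊑-refl w = 𝔹.≤-refl

⊑-trans : ∀ {n} {f g h : Opinion n} → f ⊑ g → g ⊑ h → f ⊑ h
⊑-trans f⊑g g⊑h w = 𝔹.≤-trans (f⊑g w) (g⊑h w)

val-mono-≤ : ∀ {a b} → a 𝔹.≤ b → val a ≤ val b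
val-mono-≤ 𝔹.f≤t = -≤+
val-mono-≤ 𝔹.b≤b = ℤ.≤-refl

masked : Bool → ℤ → ℤ
masked b i = if b then i else 0ℤ

masked-mono-≤ : ∀ b {i j} → i ≤ j → masked b i ≤ masked b j
masked-mono-≤ true  i≤j = i≤j
masked-mono-≤ false _   = ℤ.≤-refl

nbhdSum-mono-⊑ : ∀ {n} (K : Graph n) {f g : Opinion n} → f ⊑ g → ∀ y → nbhdSum K f y ≤ nbhdSum K g y
nbhdSum-mono-⊑ K f⊑g y = ∑-mono-≤ λ w → masked-mono-≤ (adj K y w) (val-mono-≤ (f⊑g w))

promote : ∀ {n} → Opinion n → Fin n → Opinion n
promote f w = updateAt f w (const true)

promote-at : ∀ {n} (f : Opinion n) w → promote f w w ≡ true
promote-at f w = updateAt-updates w f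

promote-off : ∀ {n} (f : Opinion n) {w x} → x ≢ w → promote f w x ≡ f x
promote-off f {w} {x} = updateAt-minimal x w f

⊑-promote : ∀ {n} (f : Opinion n) w → f ⊑ promote f w
⊑-promote f w x with x ≟ w
... | yes refl = subst (f x 𝔹.≤_) (sym (promote-at f x)) (𝔹.≤-maximum (f x))
... | no x≢w   = 𝔹.≤-reflexive (sym (promote-off f x≢w))

total-promote : ∀ {n} (f : Opinion n) {w} → f w ≡ false → total (promote f w) ≡ total f + + 2
total-promote f {w} fw = begin
  total (promote f w)                          ≡⟨ ∑-update w (λ x x≢w → cong val (promote-off f x≢w)) ⟩
  total f + (val (promote f w w) - val (f w))  ≡⟨ cong₂ (λ a b → total f + (val a - val b)) (promote-at f w) fw ⟩
  total f + + 2                                ∎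
  where open ≡-Reasoning

nbhdSum-promote : ∀ {n} (K : Graph n) (f : Opinion n) {w y} → f w ≡ false → adj K y w ≡ true →
                  nbhdSum K (promote f w) y ≡ nbhdSum K f y + + 2
nbhdSum-promote K f {w} {y} fw yw =
  trans (∑-update w (λ x x≢w → cong (masked (adj K y x) ∘ val) (promote-off f x≢w)))
        (cong (λ s → nbhdSum K f y + s) gain)
  where
  gain : masked (adj K y w) (val (promote f w w)) - masked (adj K y w) (val (f w)) ≡ + 2
  gain rewrite yw | promote-at f w | fw = refl

nbhdSum-pos : ∀ {n} (K : Graph n) (f : Opinion n) x →
              (∀ w → adj K x w ≡ true → f w ≡ true) → 0ℤ < nbhdSum K f x
nbhdSum-pos K f x all-for = ∑-pos x masked-nonneg masked-x-pos
  where
  masked-nonneg : ∀ w → 0ℤ ≤ masked (adj K x w) (val (f w))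
  masked-nonneg w with adj K x w in xw
  ... | true rewrite all-for w xw = +≤+ ℕ.z≤n
  ... | false = ℤ.≤-refl
  masked-x-pos : 0ℤ < masked (adj K x x) (val (f x))
  masked-x-pos rewrite loops K x | all-for x (loops K x) = +<+ ℕ.z<s

against-neighbour : ∀ {n} (K : Graph n) (f : Opinion n) x → nbhdSum K f x ≤ 0ℤ →
                    ∃[ w ] adj K x w ≡ true × f w ≡ false
against-neighbour K f x sum≤0 with any? (λ w → (adj K x w 𝔹.≟ true) ×-dec (f w 𝔹.≟ false))
... | yes found = found
... | no none   = contradiction (nbhdSum-pos K f x all-for) (ℤ.≤⇒≯ sum≤0)
  where
  all-for : ∀ w → adj K x w ≡ true → f w ≡ true
  all-for w xw with f w in fw
  ... | true  = refl
  ... | false = contradiction (w , xw , fw) none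

secure-vote : ∀ {n} (K : Graph n) (f : Opinion n) x →
              ∃[ f′ ] f ⊑ f′ × total f′ ≤ total f + + 2 × (0ℤ ≤ nbhdSum K f x → 0ℤ < nbhdSum K f′ x)
secure-vote K f x with 0ℤ <? nbhdSum K f x
... | yes pos = f , ⊑-refl , ℤ.i≤i+j (total f) (+ 2) , const pos
... | no ¬pos with against-neighbour K f x (ℤ.≮⇒≥ ¬pos)
...   | w , xw , fw = promote f w , ⊑-promote f w , ℤ.≤-reflexive (total-promote f fw) , gains
  where
  gains : 0ℤ ≤ nbhdSum K f x → 0ℤ < nbhdSum K (promote f w) x
  gains sum≥0 = subst (0ℤ <_) (sym (nbhdSum-promote K f fw xw)) (ℤ.+-mono-≤-< sum≥0 (+<+ ℕ.z<s))

count-mono : ∀ {n} {p q : Fin n → Bool} → (∀ x → p x ≡ true → q x ≡ true) → count p ℕ.≤ count q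
count-mono {ℕ.zero} p⇒q = ℕ.z≤n
count-mono {suc n} {p} {q} p⇒q with p zero in p₀
... | true rewrite p⇒q zero p₀ = ℕ.s≤s (count-mono (p⇒q ∘ suc))
... | false = ℕ.≤-trans (count-mono (p⇒q ∘ suc)) (ℕ.m≤n+m _ (if q zero then 1 else 0))

votesFor⇒pos : ∀ {n} (K : Graph n) (f : Opinion n) y → votesFor K f y ≡ true → 0ℤ < nbhdSum K f y
votesFor⇒pos K f y for with 0ℤ <? nbhdSum K f y
votesFor⇒pos K f y _  | yes pos = pos
votesFor⇒pos K f y () | no _

majoritarian-transfer : ∀ {n} {K K′ : Graph n} {f f′ : Opinion n} →
                        (∀ y → 0ℤ < nbhdSum K f y → 0ℤ < nbhdSum K′ f′ y) →
                        StrictlyMajoritarian K f → StrictlyMajoritarian K′ f′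
majoritarian-transfer {K = K} {K′} {f} {f′} pos⇒pos sm =
  ℕ.<-≤-trans sm (ℕ.*-monoʳ-≤ 2 (count-mono votes))
  where
  votes : ∀ y → votesFor K f y ≡ true → votesFor K′ f′ y ≡ true
  votes y = dec-true (0ℤ <? _) ∘ pos⇒pos y ∘ votesFor⇒pos K f y

majoritarian-transfer-endpoints : ∀ {n} {K K′ : Graph n} {u v : Fin n} {f f′ : Opinion n} →
  (∀ y → y ≢ u → y ≢ v → nbhdSum K f′ y ≡ nbhdSum K′ f′ y) → f ⊑ f′ →
  (0ℤ < nbhdSum K f u → 0ℤ < nbhdSum K′ f′ u) →
  (0ℤ < nbhdSum K f v → 0ℤ < nbhdSum K′ f′ v) →
  StrictlyMajoritarian K f → StrictlyMajoritarian K′ f′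
majoritarian-transfer-endpoints {K = K} {K′} {u} {v} {f} {f′} agree f⊑f′ at-u at-v =
  majoritarian-transfer {K = K} {K′} {f} {f′} pos⇒pos
  where
  pos⇒pos : ∀ y → 0ℤ < nbhdSum K f y → 0ℤ < nbhdSum K′ f′ y
  pos⇒pos y pos with y ≟ u | y ≟ v
  ... | yes refl | _        = at-u pos
  ... | no _     | yes refl = at-v pos
  ... | no y≢u   | no y≢v   =
    ℤ.<-≤-trans pos (ℤ.≤-trans (nbhdSum-mono-⊑ K f⊑f′ y) (ℤ.≤-reflexive (agree y y≢u y≢v)))

record IsEdgeDeletion {n} (G H : Graph n) (u v : Fin n) : Set where
  field
    edge    : adj G u v ≡ true
    deleted : adj H u v ≡ false
    kept    : ∀ x y → x ≢ u ⊎ y ≢ v → x ≢ v ⊎ y ≢ u → adj H x y ≡ adj G x y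

open IsEdgeDeletion

swap : ∀ {n} {G H : Graph n} {u v} → IsEdgeDeletion G H u v → IsEdgeDeletion G H v u
swap {G = G} {H} {u} {v} D = record
  { edge    = trans (Graph.sym G v u) (edge D)
  ; deleted = trans (Graph.sym H v u) (deleted D)
  ; kept    = λ x y xy≢uv xy≢vu → kept D x y xy≢vu xy≢uv
  }

endpoints-distinct : ∀ {n} {G H : Graph n} {u v} → IsEdgeDeletion G H u v → u ≢ v
endpoints-distinct {H = H} {u} D refl = contradiction (trans (sym (loops H u)) (deleted D)) λ ()

nbhdSum-off-edge : ∀ {n} {G H : Graph n} {u v} → IsEdgeDeletion G H u v →
                   ∀ f y → y ≢ u → y ≢ v → nbhdSum G f y ≡ nbhdSum H f y
nbhdSum-off-edge D f y y≢u y≢v =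
  ∑-cong λ w → cong (λ b → masked b (val (f w))) (sym (kept D y w (inj₁ y≢u) (inj₁ y≢v)))

nbhdSum-endpoint : ∀ {n} {G H : Graph n} {u v} → IsEdgeDeletion G H u v →
                   ∀ f → nbhdSum G f u ≡ nbhdSum H f u + val (f v)
nbhdSum-endpoint {G = G} {H} {u} {v} D f =
  trans (∑-update v (λ w w≢v → cong (λ b → masked b (val (f w)))
                                      (sym (kept D u w (inj₂ w≢v) (inj₁ (endpoints-distinct D))))))
        (cong (λ s → nbhdSum H f u + s) loss)
  where
  loss : masked (adj G u v) (val (f v)) - masked (adj H u v) (val (f v)) ≡ val (f v)
  loss rewrite edge D | deleted D = ℤ.+-identityʳ (val (f v))

deleteEdge-isEdgeDeletion : ∀ {n} (G : Graph n) u v (u≢v : u ≢ v) → adj G u v ≡ true →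
                            IsEdgeDeletion G (deleteEdge G u v u≢v) u v
deleteEdge-isEdgeDeletion G u v u≢v uv = record
  { edge    = uv
  ; deleted = trans (cong (λ c → adj G u v 𝔹.∧ 𝔹.not (c 𝔹.∨ (does (u ≟ v) 𝔹.∧ does (v ≟ u))))
                          (cong₂ 𝔹._∧_ (dec-true (u ≟ u) refl) (dec-true (v ≟ v) refl)))
                    (𝔹.∧-zeroʳ (adj G u v))
  ; kept    = λ x y xy≢uv xy≢vu →
      trans (cong (λ c → adj G x y 𝔹.∧ 𝔹.not c)
                  (cong₂ 𝔹._∨_ (does-∧-false (x ≟ u) (y ≟ v) xy≢uv) (does-∧-false (x ≟ v) (y ≟ u) xy≢vu)))
            (𝔹.∧-identityʳ (adj G x y))
  }
  where
  does-∧-false : ∀ {A B : Set} (a? : Dec A) (b? : Dec B) → ¬ A ⊎ ¬ B → does a? 𝔹.∧ does b? ≡ false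
  does-∧-false a? b? (inj₁ ¬a) rewrite dec-false a? ¬a = refl
  does-∧-false a? b? (inj₂ ¬b) rewrite dec-false b? ¬b = 𝔹.∧-zeroʳ (does a?)

i≤i+2+val : ∀ i b → i ≤ i + + 2 + val b
i≤i+2+val i true  = subst (i ≤_) (sym (ℤ.+-assoc i (+ 2) 1ℤ)) (ℤ.i≤i+j i (+ 3))
i≤i+2+val i false = subst (i ≤_) (sym (ℤ.+-assoc i (+ 2) -1ℤ)) (ℤ.i≤i+j i 1ℤ)

val≤2 : ∀ b → val b ≤ + 2
val≤2 true  = +≤+ (ℕ.s≤s ℕ.z≤n)
val≤2 false = -≤+

i+1>0⇒i≥0 : ∀ {i} → 0ℤ < i + 1ℤ → 0ℤ ≤ i
i+1>0⇒i≥0 {+ _}           _          = +≤+ ℕ.z≤n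
i+1>0⇒i≥0 { -[1+ ℕ.zero ]} (+<+ ())
i+1>0⇒i≥0 { -[1+ suc _ ]} ()

i≤j+k⇒i-j≤k : ∀ {i j k} → i ≤ j + k → i - j ≤ k
i≤j+k⇒i-j≤k {i} {j} {k} i≤j+k = subst (i - j ≤_) (cancel j k) (ℤ.+-monoˡ-≤ (- j) i≤j+k)
  where
  cancel : ∀ j k → j + k - j ≡ k
  cancel = solve-∀

j≤i+k⇒-k≤i-j : ∀ {i j k} → j ≤ i + k → - k ≤ i - j
j≤i+k⇒-k≤i-j {i} {j} {k} j≤i+k = subst (- k ≤_) (flip i j) (ℤ.neg-mono-≤ (i≤j+k⇒i-j≤k j≤i+k))
  where
  flip : ∀ i j → - (j - i) ≡ i - j
  flip = solve-∀

module _ {n} {G H : Graph n} {u v : Fin n} (D : IsEdgeDeletion G H u v) where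

  endpoint-gain : ∀ f → f v ≡ true → nbhdSum H f u ≤ nbhdSum G f u
  endpoint-gain f fv = begin
    nbhdSum H f u              ≤⟨ ℤ.i≤i+j _ 1ℤ ⟩
    nbhdSum H f u + val true   ≡⟨ cong (λ b → nbhdSum H f u + val b) fv ⟨
    nbhdSum H f u + val (f v)  ≡⟨ nbhdSum-endpoint D f ⟨
    nbhdSum G f u              ∎
    where open ℤ.≤-Reasoning

  endpoint-loss : ∀ f → f v ≡ false → nbhdSum G f u ≤ nbhdSum H f u
  endpoint-loss f fv = begin
    nbhdSum G f u              ≡⟨ nbhdSum-endpoint D f ⟩
    nbhdSum H f u + val (f v)  ≡⟨ cong (λ b → nbhdSum H f u + val b) fv ⟩
    nbhdSum H f u - 1ℤ         ≤⟨ ℤ.i-j≤i _ 1ℤ ⟩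
    nbhdSum H f u              ∎
    where open ℤ.≤-Reasoning

  endpoint-nonneg : ∀ f → f v ≡ true → 0ℤ < nbhdSum G f u → 0ℤ ≤ nbhdSum H f u
  endpoint-nonneg f fv pos =
    i+1>0⇒i≥0 (subst (0ℤ <_) (trans (nbhdSum-endpoint D f) (cong (λ b → nbhdSum H f u + val b) fv)) pos)

  deleteEdge-transfer : ∀ {f f′} → f ⊑ f′ →
                        (0ℤ < nbhdSum G f u → 0ℤ < nbhdSum H f′ u) →
                        (0ℤ < nbhdSum G f v → 0ℤ < nbhdSum H f′ v) →
                        StrictlyMajoritarian G f → StrictlyMajoritarian H f′
  deleteEdge-transfer {f} {f′} =
    majoritarian-transfer-endpoints {K = G} {H} {u} {v} {f} {f′} (nbhdSum-off-edge D f′)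

  addEdge-transfer : ∀ {f f′} → f ⊑ f′ →
                     (0ℤ < nbhdSum H f u → 0ℤ < nbhdSum G f′ u) →
                     (0ℤ < nbhdSum H f v → 0ℤ < nbhdSum G f′ v) →
                     StrictlyMajoritarian H f → StrictlyMajoritarian G f′
  addEdge-transfer {f} {f′} = majoritarian-transfer-endpoints {K = H} {G} {u} {v} {f} {f′}
    (λ y y≢u y≢v → sym (nbhdSum-off-edge D f′ y y≢u y≢v))

MajoritarianWithin : ∀ {n} → Graph n → ℤ → Set
MajoritarianWithin K t = ∃[ f ] StrictlyMajoritarian K f × total f ≤ t

within-promote : ∀ {n} {K : Graph n} {f : Opinion n} {w} → f w ≡ false →
                 StrictlyMajoritarian K (promote f w) → MajoritarianWithin K (total f + + 2)
within-promote {f = f} {w} fw sm = promote f w , sm , ℤ.≤-reflexive (total-promote f fw)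

module _ {n} {G H : Graph n} {u v : Fin n} (D : IsEdgeDeletion G H u v) where

  addEdge-majoritarian-++ : ∀ h → h u ≡ true → h v ≡ true →
                            StrictlyMajoritarian H h → StrictlyMajoritarian G h
  addEdge-majoritarian-++ h hu hv = addEdge-transfer D ⊑-refl
    (λ pos → ℤ.<-≤-trans pos (endpoint-gain D h hv))
    (λ pos → ℤ.<-≤-trans pos (endpoint-gain (swap D) h hu))

  addEdge-majoritarian-∙− : ∀ h → h v ≡ false →
                            StrictlyMajoritarian H h → StrictlyMajoritarian G (promote h v)
  addEdge-majoritarian-∙− h hv = addEdge-transfer D (⊑-promote h v) at-u at-v
    where
    g : Opinion n
    g = promote h v
    at-u : 0ℤ < nbhdSum H h u → 0ℤ < nbhdSum G g u
    at-u pos = ℤ.<-≤-trans pos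
      (ℤ.≤-trans (nbhdSum-mono-⊑ H (⊑-promote h v) u) (endpoint-gain D g (promote-at h v)))
    at-v : 0ℤ < nbhdSum H h v → 0ℤ < nbhdSum G g v
    at-v pos = ℤ.<-≤-trans pos (begin
      nbhdSum H h v                      ≤⟨ i≤i+2+val (nbhdSum H h v) (g u) ⟩
      nbhdSum H h v + + 2 + val (g u)    ≡⟨ cong (λ s → s + val (g u)) (nbhdSum-promote H h hv (loops H v)) ⟨
      nbhdSum H g v + val (g u)          ≡⟨ nbhdSum-endpoint (swap D) g ⟨
      nbhdSum G g v                      ∎)
      where open ℤ.≤-Reasoning

  deleteEdge-majoritarian-−− : ∀ f → f u ≡ false → f v ≡ false →
                               StrictlyMajoritarian G f → StrictlyMajoritarian H f
  deleteEdge-majoritarian-−− f fu fv = deleteEdge-transfer D ⊑-refl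
    (λ pos → ℤ.<-≤-trans pos (endpoint-loss D f fv))
    (λ pos → ℤ.<-≤-trans pos (endpoint-loss (swap D) f fu))

  deleteEdge-majoritarian-∙− : ∀ f → f v ≡ false →
                               StrictlyMajoritarian G f → StrictlyMajoritarian H (promote f v)
  deleteEdge-majoritarian-∙− f fv = deleteEdge-transfer D (⊑-promote f v) at-u at-v
    where
    f′ : Opinion n
    f′ = promote f v
    at-u : 0ℤ < nbhdSum G f u → 0ℤ < nbhdSum H f′ u
    at-u pos = ℤ.<-≤-trans pos (ℤ.≤-trans (endpoint-loss D f fv) (nbhdSum-mono-⊑ H (⊑-promote f v) u))
    at-v : 0ℤ < nbhdSum G f v → 0ℤ < nbhdSum H f′ v
    at-v pos = ℤ.<-≤-trans pos (begin
      nbhdSum G f v               ≡⟨ nbhdSum-endpoint (swap D) f ⟩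
      nbhdSum H f v + val (f u)   ≤⟨ ℤ.+-monoʳ-≤ (nbhdSum H f v) (val≤2 (f u)) ⟩
      nbhdSum H f v + + 2         ≡⟨ nbhdSum-promote H f fv (loops H v) ⟨
      nbhdSum H f′ v              ∎)
      where open ℤ.≤-Reasoning

  deleteEdge-within-++ : ∀ f → f u ≡ true → f v ≡ true →
                         StrictlyMajoritarian G f → MajoritarianWithin H (total f + + 4)
  deleteEdge-within-++ f fu fv sm with secure-vote H f u
  ... | f₁ , f⊑f₁ , cost₁ , secures-u with secure-vote H f₁ v
  ...   | f₂ , f₁⊑f₂ , cost₂ , secures-v =
    f₂ , deleteEdge-transfer D (⊑-trans f⊑f₁ f₁⊑f₂) at-u at-v sm , cost
    where
    at-u : 0ℤ < nbhdSum G f u → 0ℤ < nbhdSum H f₂ u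
    at-u pos = ℤ.<-≤-trans (secures-u (endpoint-nonneg D f fv pos)) (nbhdSum-mono-⊑ H f₁⊑f₂ u)
    at-v : 0ℤ < nbhdSum G f v → 0ℤ < nbhdSum H f₂ v
    at-v pos = secures-v (ℤ.≤-trans (endpoint-nonneg (swap D) f fu pos) (nbhdSum-mono-⊑ H f⊑f₁ v))
    cost : total f₂ ≤ total f + + 4
    cost = begin
      total f₂              ≤⟨ cost₂ ⟩
      total f₁ + + 2        ≤⟨ ℤ.+-monoˡ-≤ (+ 2) cost₁ ⟩
      total f + + 2 + + 2   ≡⟨ ℤ.+-assoc (total f) (+ 2) (+ 2) ⟩
      total f + + 4         ∎
      where open ℤ.≤-Reasoning

addEdge-within : ∀ {n} {G H : Graph n} {u v} → IsEdgeDeletion G H u v → ∀ h →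
                 StrictlyMajoritarian H h → MajoritarianWithin G (total h + + 2)
addEdge-within {G = G} {u = u} {v} D h sm with h u in hu | h v in hv
... | _     | false = within-promote {K = G} hv (addEdge-majoritarian-∙− D h hv sm)
... | false | true  = within-promote {K = G} hu (addEdge-majoritarian-∙− (swap D) h hu sm)
... | true  | true  = h , addEdge-majoritarian-++ D h hu hv sm , ℤ.i≤i+j (total h) (+ 2)

deleteEdge-within-≢ : ∀ {n} {G H : Graph n} {u v} → IsEdgeDeletion G H u v → ∀ f → f u ≢ f v →
                      StrictlyMajoritarian G f → MajoritarianWithin H (total f + + 2)
deleteEdge-within-≢ {H = H} {u} {v} D f fu≢fv sm with f u in fu | f v in fv
... | _     | false = within-promote {K = H} fv (deleteEdge-majoritarian-∙− D f fv sm)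
... | false | true  = within-promote {K = H} fu (deleteEdge-majoritarian-∙− (swap D) f fu sm)
... | true  | true  = contradiction refl fu≢fv

γ≤-within : ∀ {n} {K : Graph n} {γ t} → IsStrictDomNumber K γ → MajoritarianWithin K t → γ ≤ t
γ≤-within (_ , γ-min) (f , sm , f≤t) = ℤ.≤-trans (γ-min f sm) f≤t

optimal⇒total≡γ : ∀ {n} {K : Graph n} {f γ} → Optimal K f → IsStrictDomNumber K γ → total f ≡ γ
optimal⇒total≡γ {f = f} (sm , f-min) ((g , g-sm , g≡γ) , γ-min) =
  ℤ.≤-antisym (subst (total f ≤_) g≡γ (f-min g g-sm)) (γ-min f sm)

γ-gap-upper : ∀ {n} {K K′ : Graph n} {γ γ′ k} → IsStrictDomNumber K γ → IsStrictDomNumber K′ γ′ →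
              (∀ h → StrictlyMajoritarian K′ h → MajoritarianWithin K (total h + k)) → γ - γ′ ≤ k
γ-gap-upper {K = K} {k = k} γ-spec ((h , h-sm , h≡γ′) , _) lift =
  i≤j+k⇒i-j≤k (γ≤-within {K = K} γ-spec (subst (λ t → MajoritarianWithin K (t + k)) h≡γ′ (lift h h-sm)))

γ-gap-lower : ∀ {n} {K K′ : Graph n} {f γ γ′ k} → Optimal K f →
              IsStrictDomNumber K γ → IsStrictDomNumber K′ γ′ →
              MajoritarianWithin K′ (total f + k) → - k ≤ γ - γ′
γ-gap-lower {K = K} {K′} {f} {γ} {γ′} {k} f-opt γ-spec γ′-spec within =
  j≤i+k⇒-k≤i-j {γ} {γ′} {k} (γ≤-within {K = K′} γ′-spec (subst (λ t → MajoritarianWithin K′ (t + k)) f≡γ within))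
  where
  f≡γ : total f ≡ γ
  f≡γ = optimal⇒total≡γ {K = K} {f} f-opt γ-spec

lemma2 : ∀ {n : ℕ} (G : Graph (suc n)) (u v : Fin (suc n)) (u≢v : ¬ (u ≡ v))
         → adj G u v ≡ true
         → (f : Opinion (suc n)) → Optimal G f
         → (γG γH : ℤ)
         → IsStrictDomNumber G γG
         → IsStrictDomNumber (deleteEdge G u v u≢v) γH
         → (f u ≡ true → f v ≡ true → -[1+ 3 ] ≤ γG - γH × γG - γH ≤ + 2)
           × (f u ≡ false → f v ≡ false → + 0 ≤ γG - γH × γG - γH ≤ + 2)
           × (¬ (f u ≡ f v) → -[1+ 1 ] ≤ γG - γH × γG - γH ≤ + 2)
lemma2 {n} G u v u≢v uv f f-opt@(f-sm , _) γG γH γG-spec γH-spec =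
    (λ fu fv → lower (deleteEdge-within-++ D f fu fv f-sm) , upper)
  , (λ fu fv → lower (f , deleteEdge-majoritarian-−− D f fu fv f-sm , ℤ.i≤i+j (total f) (+ 0)) , upper)
  , (λ fu≢fv → lower (deleteEdge-within-≢ D f fu≢fv f-sm) , upper)
  where
  H : Graph (suc n)
  H = deleteEdge G u v u≢v
  D : IsEdgeDeletion G H u v
  D = deleteEdge-isEdgeDeletion G u v u≢v uv
  upper : γG - γH ≤ + 2
  upper = γ-gap-upper {K = G} {H} γG-spec γH-spec (addEdge-within D)
  lower : ∀ {k} → MajoritarianWithin H (total f + + k) → - + k ≤ γG - γH
  lower = γ-gap-lower {K = G} {H} {f} f-opt γG-spec γH-spec
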